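{- Let $G$ be a graph belonging to an association scheme. If the Grover walk on $G$ exhibits perfect state transfer from a vertex $u$ to a vertex $v$ and also from $u$ to a vertex $w$, then $v=w$.
   Context: Grover walk: let $G$ be a finite simple graph without isolated vertices. Its symmetric arc set is $\mathcal{A}(G)=\{(u,v),(v,u):uv\in E(G)\}$; for $a=(u,v)$, $t(a)=v$, $a^{ -1}=(v,u)$. Shift matrix $S_{ab}=\delta_{a,b^{ -1}}$; boundary matrix $N\in\mathbb{C}^{V(G)\times\mathcal{A}(G)}$, $N_{ua}=\frac{1}{\sqrt{\deg u}}\delta_{u,t(a)}$; coin $K=2N^*N-I$; time evolution matrix $U=SK$. For a vertex $u$ let $\Phi_u=N^*\mathbf{e}_u$. $G$ exhibits perfect state transfer from $u$ to a vertex $v\neq u$ (at some time) if $U^\tau\Phi_u=\gamma\Phi_v$ for some positive integer $\tau$ and some unimodular $\gamma\in\mathbb{C}$. Association scheme with $d$ classes: a set $\{A_0,\dots,A_d\}$ of $n\times n$ $(0,1)$-matrices with $A_0=I$, $\sum_iA_i=J$, each $A_i$ symmetric, and each $A_iA_j$ a linear combination of $A_0,\dots,A_d$. A graph belongs to the scheme if its adjacency matrix lies in the span of $A_0,\dots,A_d$. -}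

module Defs where

open import Data.Bool using (Bool; true; false; if_then_else_)
open import Data.Nat as ℕ using (ℕ; zero; suc)
open import Data.Integer using (+_)
open import Data.Fin using (Fin; zero; suc; _≟_)
open import Data.Product using (Σ; ∃; _×_; _,_)
open import Data.Sum using (_⊎_)
open import Relation.Nullary using (¬_; yes; no)
open import Relation.Binary.PropositionalEquality using (_≡_)
open import Data.Rational using (ℚ; 0ℚ; 1ℚ; _+_; _*_; _-_; _/_)
open import Function using (_∘_)

Σℚ : ∀ {n} → (Fin n → ℚ) → ℚ
Σℚ {zero}  f = 0ℚ
Σℚ {suc n} f = f zero + Σℚ (f ∘ suc)

Σℕ : ∀ {n} → (Fin n → ℕ) → ℕ
Σℕ {zero}  f = 0
Σℕ {suc n} f = f zero ℕ.+ Σℕ (f ∘ suc)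

[_]ℚ : Bool → ℚ
[ b ]ℚ = if b then 1ℚ else 0ℚ

[_]ℕ : Bool → ℕ
[ b ]ℕ = if b then 1 else 0

δ : ∀ {n} → Fin n → Fin n → ℚ
δ x y with x ≟ y
... | yes _ = 1ℚ
... | no  _ = 0ℚ

-- 1/k for k ≥ 1 (and 0 for k = 0; never used on arcs since G has no isolated vertices)
inv : ℕ → ℚ
inv zero    = 0ℚ
inv (suc k) = + 1 / suc k

record Graph (n : ℕ) : Set where
  field
    adj        : Fin n → Fin n → Bool
    symmetric  : ∀ x y → adj x y ≡ adj y x
    loopless   : ∀ x → adj x x ≡ false
    noIsolated : ∀ x → ∃ λ y → adj x y ≡ true

module _ {n : ℕ} (G : Graph n) where
  open Graph G

  deg : Fin n → ℕ
  deg x = Σℕ (λ y → [ adj x y ]ℕ)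

  adjMat : Fin n → Fin n → ℚ
  adjMat x y = [ adj x y ]ℚ

  -- Vectors in ℂ^{A(G)} are represented as functions on ordered pairs
  -- (x , y) standing for the arc (x , y); only values on arcs matter.
  -- All entries of U are rational, so rational vectors suffice.
  ArcVec : Set
  ArcVec = Fin n → Fin n → ℚ

  onArcs : ArcVec → ArcVec
  onArcs f x y = [ adj x y ]ℚ * f x y

  NstarN : ArcVec → ArcVec
  NstarN f x y = [ adj x y ]ℚ * (inv (deg y) * Σℚ (λ z → [ adj z y ]ℚ * f z y))

  coin : ArcVec → ArcVec
  coin f x y = onArcs (λ a b → (NstarN f a b + NstarN f a b) - f a b) x y

  shift : ArcVec → ArcVec
  shift f x y = onArcs (λ a b → f b a) x y

  U : ArcVec → ArcVec
  U f = shift (coin f)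

  Upow : ℕ → ArcVec → ArcVec
  Upow zero    f = onArcs f
  Upow (suc k) f = U (Upow k f)

  -- χ_u = √(deg u) · Φ_u : indicator of arcs with terminal vertex u
  χ : Fin n → ArcVec
  χ u x y = [ adj x y ]ℚ * δ y u

  -- Perfect state transfer from u to v (u ≠ v):
  -- U^τ Φ_u = γ Φ_v with τ ≥ 1, |γ| = 1.  Writing Φ_u = χ_u/√deg u,
  -- this reads U^τ χ_u = c χ_v with c = γ √(deg u / deg v); since U and χ
  -- are rational, c is rational, and |γ| = 1 iff c² · deg v = deg u.
  PST : Fin n → Fin n → Set
  PST u v = ¬ (u ≡ v) × Σ ℕ λ τ → Σ ℚ λ c →
              (1 ℕ.≤ τ) ×
              (∀ x y → Upow τ (χ u) x y ≡ c * χ v x y) ×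
              (c * c * ((+ deg v) / 1) ≡ (+ deg u) / 1)

record AssociationScheme (n d : ℕ) : Set where
  field
    A         : Fin (suc d) → Fin n → Fin n → ℚ
    zeroOne   : ∀ i x y → A i x y ≡ 0ℚ ⊎ A i x y ≡ 1ℚ
    A₀≡I      : ∀ x y → A zero x y ≡ δ x y
    sum≡J     : ∀ x y → Σℚ (λ i → A i x y) ≡ 1ℚ
    symm      : ∀ i x y → A i x y ≡ A i y x
    closed    : ∀ i j → Σ (Fin (suc d) → ℚ) λ c →
                  ∀ x y → Σℚ (λ z → A i x z * A j z y) ≡ Σℚ (λ k → c k * A k x y)

BelongsTo : ∀ {n d} → Graph n → AssociationScheme n d → Set
BelongsTo {n} {d} G 𝒜 = Σ (Fin (suc d) → ℚ) λ c →
  ∀ x y → adjMat G x y ≡ Σℚ (λ k → c k * AssociationScheme.A 𝒜 k x y)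

module Submission where

-- Write W_t(y, x) = ⟨χ_y, U^t χ_x⟩. For every graph, W₀ = D, W₁ = A and
-- W_{t+2} = 2 A D⁻¹ W_{t+1} − W_t; a graph of an association scheme is regular, so every W_t
-- lies in the Bose–Mesner algebra and in particular is symmetric. Perfect state transfer
-- u → v at time τ makes column u of W_τ equal to c k e_v with c = ±1. If i is the class of
-- (v, u), the coefficient of A_i in W_τ is therefore c k and column u of A_i is e_v; column
-- sums in a scheme are constant, so every column x of A_i has a 1, in row σ x say, and
-- W_τ(σ x, x) = c k. As U preserves norms, equality in Cauchy–Schwarz gives U^τ χ_x = c χ_{σ x}
-- for all x, and the symmetry of W_τ makes σ an involution. Transfer maps at times s ≤ t give
-- one at time t − s, and time 0 only allows the identity, so Euclid's algorithm on the two
-- times shows that the maps σ, σ′ of two transfers from u are trivial or equal. Since σ u = v ≠ u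
-- and σ′ u = w ≠ u, we get v = w.

open import Defs
open import Data.Nat using (ℕ)
open import Data.Fin using (Fin)
open import Relation.Binary.PropositionalEquality using (_≡_)

open import Algebra.Bundles using (CommutativeRing)
import Algebra.Properties.CommutativeMonoid.Sum as MonoidSum
import Algebra.Properties.Semiring.Sum as SemiringSum
open import Data.Bool using (Bool; true; false)
open import Data.Empty using (⊥-elim)
open import Data.Fin using (zero; suc; _≟_)
open import Data.Fin.Properties using (suc-injective)
open import Data.Integer as ℤ using ()
import Data.Integer.Properties as ℤ
open import Data.Nat as ℕ using (zero; suc)
import Data.Nat.Coprimality as C
open import Data.Nat.Induction using (<-wellFounded)
import Data.Nat.Properties as ℕ
open import Data.Product using (∃; _×_; _,_; proj₁; proj₂; map₂)
open import Data.Rational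
  using (ℚ; 0ℚ; 1ℚ; _+_; _*_; _-_; -_; _≤_; _/_; 1/_; mkℚ; ≢-nonZero; nonNegative; nonPositive)
open import Data.Rational.Properties renaming (_≟_ to _≟ℚ_)
open import Algebra.Properties.Group +-0-group using (x∙y⁻¹≈ε⇒x≈y)
open import Data.Sum using (_⊎_; inj₁; inj₂)
open import Function using (_∘_)
open import Induction.WellFounded using (Acc; acc)
open import Level using (0ℓ)
open import Relation.Binary.Definitions using (tri<; tri≈; tri>)
open import Relation.Binary.PropositionalEquality
  using (refl; sym; trans; cong; cong₂; subst; _≢_; module ≡-Reasoning)
open import Relation.Nullary using (yes; no)
open import Relation.Nullary.Decidable using (dec⇒maybe)
open import Tactic.RingSolver using (solve-∀)
import Tactic.RingSolver.Core.AlmostCommutativeRing as ACR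

ℚ-ring : ACR.AlmostCommutativeRing 0ℓ 0ℓ
ℚ-ring = ACR.fromCommutativeRing +-*-commutativeRing (λ x → dec⇒maybe (0ℚ ≟ℚ x))

open MonoidSum +-0-commutativeMonoid using (sum; sum-cong-≗; ∑-distrib-+; ∑-comm)
open SemiringSum (CommutativeRing.semiring +-*-commutativeRing) using (*-distribˡ-sum; *-distribʳ-sum)

-- Finite sums

Σℚ≡sum : ∀ {n} (f : Fin n → ℚ) → Σℚ f ≡ sum f
Σℚ≡sum {zero}  f = refl
Σℚ≡sum {suc n} f = cong (f zero +_) (Σℚ≡sum (f ∘ suc))

Σℚ-cong : ∀ {n} {f g : Fin n → ℚ} → (∀ i → f i ≡ g i) → Σℚ f ≡ Σℚ g
Σℚ-cong {f = f} {g} f≗g = begin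
  Σℚ f ≡⟨ Σℚ≡sum f ⟩ sum f ≡⟨ sum-cong-≗ f≗g ⟩ sum g ≡⟨ Σℚ≡sum g ⟨ Σℚ g ∎
  where open ≡-Reasoning

Σℚ-distrib-+ : ∀ {n} (f g : Fin n → ℚ) → Σℚ (λ i → f i + g i) ≡ Σℚ f + Σℚ g
Σℚ-distrib-+ f g = begin
  Σℚ (λ i → f i + g i)     ≡⟨ Σℚ≡sum (λ i → f i + g i) ⟩
  sum (λ i → f i + g i)    ≡⟨ ∑-distrib-+ f g ⟩
  sum f + sum g            ≡⟨ cong₂ _+_ (Σℚ≡sum f) (Σℚ≡sum g) ⟨
  Σℚ f + Σℚ g              ∎
  where open ≡-Reasoning

*-distribˡ-Σℚ : ∀ {n} c (f : Fin n → ℚ) → c * Σℚ f ≡ Σℚ (λ i → c * f i)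
*-distribˡ-Σℚ c f = begin
  c * Σℚ f                 ≡⟨ cong (c *_) (Σℚ≡sum f) ⟩
  c * sum f                ≡⟨ *-distribˡ-sum c f ⟩
  sum (λ i → c * f i)      ≡⟨ Σℚ≡sum (λ i → c * f i) ⟨
  Σℚ (λ i → c * f i)       ∎
  where open ≡-Reasoning

*-distribʳ-Σℚ : ∀ {n} c (f : Fin n → ℚ) → Σℚ f * c ≡ Σℚ (λ i → f i * c)
*-distribʳ-Σℚ c f = begin
  Σℚ f * c                 ≡⟨ cong (_* c) (Σℚ≡sum f) ⟩
  sum f * c                ≡⟨ *-distribʳ-sum c f ⟩
  sum (λ i → f i * c)      ≡⟨ Σℚ≡sum (λ i → f i * c) ⟨
  Σℚ (λ i → f i * c)       ∎
  where open ≡-Reasoning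

Σℚ-comm : ∀ {m n} (f : Fin m → Fin n → ℚ) →
          Σℚ (λ i → Σℚ (λ j → f i j)) ≡ Σℚ (λ j → Σℚ (λ i → f i j))
Σℚ-comm f = begin
  Σℚ (λ i → Σℚ (f i))              ≡⟨ trans (Σℚ-cong (λ i → Σℚ≡sum (f i))) (Σℚ≡sum (λ i → sum (f i))) ⟩
  sum (λ i → sum (f i))            ≡⟨ ∑-comm f ⟩
  sum (λ j → sum (λ i → f i j))    ≡⟨ trans (Σℚ-cong (λ j → Σℚ≡sum (λ i → f i j))) (Σℚ≡sum (λ j → sum (λ i → f i j))) ⟨
  Σℚ (λ j → Σℚ (λ i → f i j))      ∎
  where open ≡-Reasoning

Σℚ-distrib-- : ∀ {n} (f g : Fin n → ℚ) → Σℚ (λ i → f i - g i) ≡ Σℚ f - Σℚ g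
Σℚ-distrib-- {zero}  f g = refl
Σℚ-distrib-- {suc n} f g = begin
  (f zero - g zero) + Σℚ (λ i → f (suc i) - g (suc i))
    ≡⟨ cong ((f zero - g zero) +_) (Σℚ-distrib-- (f ∘ suc) (g ∘ suc)) ⟩
  (f zero - g zero) + (Σℚ (f ∘ suc) - Σℚ (g ∘ suc))
    ≡⟨ interchange (f zero) (g zero) (Σℚ (f ∘ suc)) (Σℚ (g ∘ suc)) ⟩
  (f zero + Σℚ (f ∘ suc)) - (g zero + Σℚ (g ∘ suc)) ∎
  where
  open ≡-Reasoning
  interchange : ∀ a b c d → (a - b) + (c - d) ≡ (a + c) - (b + d)
  interchange = solve-∀ ℚ-ring

Σℚ-linear : ∀ {n} s t (f g k : Fin n → ℚ) →
            Σℚ (λ i → (f i - s * g i) + t * k i) ≡ (Σℚ f - s * Σℚ g) + t * Σℚ k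
Σℚ-linear s t f g k = begin
  Σℚ (λ i → (f i - s * g i) + t * k i)
    ≡⟨ Σℚ-distrib-+ (λ i → f i - s * g i) (λ i → t * k i) ⟩
  Σℚ (λ i → f i - s * g i) + Σℚ (λ i → t * k i)
    ≡⟨ cong (_+ Σℚ (λ i → t * k i)) (Σℚ-distrib-- f (λ i → s * g i)) ⟩
  (Σℚ f - Σℚ (λ i → s * g i)) + Σℚ (λ i → t * k i)
    ≡⟨ cong₂ (λ p q → (Σℚ f - p) + q) (*-distribˡ-Σℚ s g) (*-distribˡ-Σℚ t k) ⟨
  (Σℚ f - s * Σℚ g) + t * Σℚ k ∎
  where open ≡-Reasoning

Σℚ-zero : ∀ {n} → Σℚ {n} (λ _ → 0ℚ) ≡ 0ℚ
Σℚ-zero {zero}  = refl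
Σℚ-zero {suc n} = trans (+-identityˡ _) (Σℚ-zero {n})

Σℚ-single : ∀ {n} (f : Fin n → ℚ) a → (∀ i → i ≢ a → f i ≡ 0ℚ) → Σℚ f ≡ f a
Σℚ-single {suc n} f zero    off = begin
  f zero + Σℚ (f ∘ suc)   ≡⟨ cong (f zero +_) (trans (Σℚ-cong (λ i → off (suc i) λ ())) (Σℚ-zero {n})) ⟩
  f zero + 0ℚ             ≡⟨ +-identityʳ (f zero) ⟩
  f zero                  ∎
  where open ≡-Reasoning
Σℚ-single {suc n} f (suc a) off = begin
  f zero + Σℚ (f ∘ suc)   ≡⟨ cong (_+ Σℚ (f ∘ suc)) (off zero λ ()) ⟩
  0ℚ + Σℚ (f ∘ suc)       ≡⟨ +-identityˡ _ ⟩
  Σℚ (f ∘ suc)            ≡⟨ Σℚ-single (f ∘ suc) a (λ i i≢a → off (suc i) (i≢a ∘ suc-injective)) ⟩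
  f (suc a)               ∎
  where open ≡-Reasoning

Σℚ*Σℚ : ∀ {m k} (f : Fin m → ℚ) (g : Fin k → ℚ) → Σℚ f * Σℚ g ≡ Σℚ (λ i → Σℚ (λ j → f i * g j))
Σℚ*Σℚ f g = trans (*-distribʳ-Σℚ (Σℚ g) f) (Σℚ-cong λ i → *-distribˡ-Σℚ (f i) g)

δ-refl : ∀ {n} (a : Fin n) → δ a a ≡ 1ℚ
δ-refl a with a ≟ a
... | yes _   = refl
... | no a≢a = ⊥-elim (a≢a refl)

δ-≢ : ∀ {n} {a b : Fin n} → a ≢ b → δ a b ≡ 0ℚ
δ-≢ {a = a} {b} a≢b with a ≟ b
... | yes a≡b = ⊥-elim (a≢b a≡b)
... | no _    = refl

δ≢0⇒≡ : ∀ {n} {a b : Fin n} → δ a b ≢ 0ℚ → a ≡ b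
δ≢0⇒≡ {a = a} {b} δ≢0 with a ≟ b
... | yes a≡b = a≡b
... | no _    = ⊥-elim (δ≢0 refl)

Σℚ-*δ : ∀ {n} (f : Fin n → ℚ) a → Σℚ (λ i → f i * δ i a) ≡ f a
Σℚ-*δ f a = begin
  Σℚ (λ i → f i * δ i a)  ≡⟨ Σℚ-single (λ i → f i * δ i a) a (λ i i≢a → trans (cong (f i *_) (δ-≢ i≢a)) (*-zeroʳ (f i))) ⟩
  f a * δ a a             ≡⟨ cong (f a *_) (δ-refl a) ⟩
  f a * 1ℚ                ≡⟨ *-identityʳ (f a) ⟩
  f a                     ∎
  where open ≡-Reasoning

Σℚ-nonneg : ∀ {n} (f : Fin n → ℚ) → (∀ i → 0ℚ ≤ f i) → 0ℚ ≤ Σℚ f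
Σℚ-nonneg {zero}  f f≥0 = ≤-refl
Σℚ-nonneg {suc n} f f≥0 = +-mono-≤ (f≥0 zero) (Σℚ-nonneg (f ∘ suc) (f≥0 ∘ suc))

term≤Σℚ : ∀ {n} (f : Fin n → ℚ) → (∀ i → 0ℚ ≤ f i) → ∀ a → f a ≤ Σℚ f
term≤Σℚ {suc n} f f≥0 zero = begin
  f zero                  ≡⟨ +-identityʳ (f zero) ⟨
  f zero + 0ℚ             ≤⟨ +-monoʳ-≤ (f zero) (Σℚ-nonneg (f ∘ suc) (f≥0 ∘ suc)) ⟩
  f zero + Σℚ (f ∘ suc)   ∎
  where open ≤-Reasoning
term≤Σℚ {suc n} f f≥0 (suc a) = begin
  f (suc a)               ≡⟨ +-identityˡ (f (suc a)) ⟨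
  0ℚ + f (suc a)          ≤⟨ +-mono-≤ (f≥0 zero) (term≤Σℚ (f ∘ suc) (f≥0 ∘ suc) a) ⟩
  f zero + Σℚ (f ∘ suc)   ∎
  where open ≤-Reasoning

Σℚ≡0⇒≡0 : ∀ {n} (f : Fin n → ℚ) → (∀ i → 0ℚ ≤ f i) → Σℚ f ≡ 0ℚ → ∀ a → f a ≡ 0ℚ
Σℚ≡0⇒≡0 f f≥0 Σf≡0 a = ≤-antisym (≤-trans (term≤Σℚ f f≥0 a) (≤-reflexive Σf≡0)) (f≥0 a)

Σℚ≢0⇒∃≢0 : ∀ {n} (f : Fin n → ℚ) → Σℚ f ≢ 0ℚ → ∃ λ i → f i ≢ 0ℚ
Σℚ≢0⇒∃≢0 {zero}  f Σf≢0 = ⊥-elim (Σf≢0 refl)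
Σℚ≢0⇒∃≢0 {suc n} f Σf≢0 with f zero ≟ℚ 0ℚ
... | no f₀≢0 = zero , f₀≢0
... | yes f₀≡0 with Σℚ≢0⇒∃≢0 (f ∘ suc) (λ Σ≡0 → Σf≢0 (trans (cong₂ _+_ f₀≡0 Σ≡0) (+-identityˡ 0ℚ)))
...   | i , fᵢ≢0 = suc i , fᵢ≢0

-- Rational arithmetic

*≡1⇒≢0 : ∀ {p q} → p * q ≡ 1ℚ → p ≢ 0ℚ
*≡1⇒≢0 {q = q} pq≡1 p≡0 = 1≢0 (trans (sym pq≡1) (trans (cong (_* q) p≡0) (*-zeroˡ q)))

square-product : ∀ {p q} → p * p ≡ 1ℚ → q * q ≡ 1ℚ → (p * q) * (p * q) ≡ 1ℚ
square-product {p} {q} p²≡1 q²≡1 = begin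
  (p * q) * (p * q)   ≡⟨ regroup p q ⟩
  (p * p) * (q * q)   ≡⟨ cong₂ _*_ p²≡1 q²≡1 ⟩
  1ℚ * 1ℚ             ≡⟨⟩
  1ℚ                  ∎
  where
  open ≡-Reasoning
  regroup : ∀ a b → (a * b) * (a * b) ≡ (a * a) * (b * b)
  regroup = solve-∀ ℚ-ring

0≤p*p : ∀ p → 0ℚ ≤ p * p
0≤p*p p with ≤-total 0ℚ p
... | inj₁ 0≤p = nonNegative⁻¹ (p * p) {{nonNeg*nonNeg⇒nonNeg p {{nonNegative 0≤p}} p {{nonNegative 0≤p}}}}
... | inj₂ p≤0 = nonNegative⁻¹ (p * p) {{nonPos*nonPos⇒nonPos p {{nonPositive p≤0}} p {{nonPositive p≤0}}}}

p*p≡0⇒p≡0 : ∀ p → p * p ≡ 0ℚ → p ≡ 0ℚ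
p*p≡0⇒p≡0 p p²≡0 with p ≟ℚ 0ℚ
... | yes p≡0 = p≡0
... | no p≢0  = ⊥-elim (*≡1⇒≢0 p²·p⁻²≡1 p²≡0)
  where
  instance _ = ≢-nonZero p≢0
  p²·p⁻²≡1 : p * p * (1/ p * 1/ p) ≡ 1ℚ
  p²·p⁻²≡1 = begin
    p * p * (1/ p * 1/ p)         ≡⟨ regroup p (1/ p) ⟩
    (p * 1/ p) * (p * 1/ p)       ≡⟨ cong₂ _*_ (*-inverseʳ p) (*-inverseʳ p) ⟩
    1ℚ * 1ℚ                       ≡⟨⟩
    1ℚ                            ∎
    where
    open ≡-Reasoning
    regroup : ∀ a b → a * a * (b * b) ≡ (a * b) * (a * b)
    regroup = solve-∀ ℚ-ring

/1≡mkℚ : ∀ m → (ℤ.+ m) / 1 ≡ mkℚ (ℤ.+ m) 0 (C.sym (C.1-coprimeTo m))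
/1≡mkℚ m = normalize-coprime (C.sym (C.1-coprimeTo m))

/1-suc : ∀ m → (ℤ.+ suc m) / 1 ≡ 1ℚ + (ℤ.+ m) / 1
/1-suc m rewrite /1≡mkℚ m = cong (λ k → (ℤ.+ 1 ℤ.+ k) / 1) (sym (ℤ.*-identityʳ (ℤ.+ m)))

inv-suc : ∀ m → inv (suc m) * ((ℤ.+ suc m) / 1) ≡ 1ℚ
inv-suc m rewrite /1≡mkℚ (suc m) | normalize-coprime (C.1-coprimeTo (suc m)) =
  *-inverseˡ (mkℚ (ℤ.+ suc m) 0 (C.sym (C.1-coprimeTo (suc m))))

Σℚ[]≡Σℕ[] : ∀ {k} (b : Fin k → Bool) → Σℚ (λ i → [ b i ]ℚ) ≡ (ℤ.+ Σℕ (λ i → [ b i ]ℕ)) / 1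
Σℚ[]≡Σℕ[] {zero}  b = refl
Σℚ[]≡Σℕ[] {suc k} b with b zero
... | true  = trans (cong (1ℚ +_) (Σℚ[]≡Σℕ[] (b ∘ suc))) (sym (/1-suc (Σℕ (λ i → [ b (suc i) ]ℕ))))
... | false = trans (+-identityˡ _) (Σℚ[]≡Σℕ[] (b ∘ suc))

Σℕ[]-pos : ∀ {k} (b : Fin k → Bool) i → b i ≡ true → ∃ λ m → Σℕ (λ j → [ b j ]ℕ) ≡ suc m
Σℕ[]-pos b zero    bᵢ rewrite bᵢ = Σℕ (λ j → [ b (suc j) ]ℕ) , refl
Σℕ[]-pos b (suc i) bᵢ with Σℕ[]-pos (b ∘ suc) i bᵢ | b zero
... | m , Σ≡1+m | true  = suc m , cong suc Σ≡1+m
... | m , Σ≡1+m | false = m , Σ≡1+m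

-- The Grover walk on an arbitrary graph

module _ {n : ℕ} where

  infix 4 _≈_

  _≈_ : (Fin n → Fin n → ℚ) → (Fin n → Fin n → ℚ) → Set
  f ≈ g = ∀ x y → f x y ≡ g x y

  scale : ℚ → (Fin n → Fin n → ℚ) → Fin n → Fin n → ℚ
  scale c f x y = c * f x y

  ⟪_,_⟫ : (Fin n → Fin n → ℚ) → (Fin n → Fin n → ℚ) → ℚ
  ⟪ f , g ⟫ = Σℚ λ x → Σℚ λ y → f x y * g x y

  ⟪⟫-cong : ∀ {f f′ g g′} → f ≈ f′ → g ≈ g′ → ⟪ f , g ⟫ ≡ ⟪ f′ , g′ ⟫
  ⟪⟫-cong f≈f′ g≈g′ = Σℚ-cong λ x → Σℚ-cong λ y → cong₂ _*_ (f≈f′ x y) (g≈g′ x y)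

  ⟪f,f⟫≡0⇒f≈0 : ∀ f → ⟪ f , f ⟫ ≡ 0ℚ → f ≈ λ _ _ → 0ℚ
  ⟪f,f⟫≡0⇒f≈0 f ⟪f,f⟫≡0 x y = p*p≡0⇒p≡0 (f x y) (Σℚ≡0⇒≡0 _ (λ y → 0≤p*p (f x y)) row≡0 y)
    where
    row≡0 : Σℚ (λ y → f x y * f x y) ≡ 0ℚ
    row≡0 = Σℚ≡0⇒≡0 _ (λ x → Σℚ-nonneg _ λ y → 0≤p*p (f x y)) ⟪f,f⟫≡0 x

  cauchy-schwarz-equality : ∀ h g c K → ⟪ h , h ⟫ ≡ K → ⟪ g , h ⟫ ≡ c * K → ⟪ g , g ⟫ ≡ K →
                            c * c ≡ 1ℚ → h ≈ scale c g
  cauchy-schwarz-equality h g c K ⟪h,h⟫≡K ⟪g,h⟫≡cK ⟪g,g⟫≡K c²≡1 x y =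
    x∙y⁻¹≈ε⇒x≈y (h x y) (c * g x y) (⟪f,f⟫≡0⇒f≈0 d ‖d‖²≡0 x y)
    where
    d : Fin n → Fin n → ℚ
    d x y = h x y - c * g x y
    expand : ∀ c p q → (p - c * q) * (p - c * q) ≡ (p * p - (c + c) * (q * p)) + c * c * (q * q)
    expand = solve-∀ ℚ-ring
    ‖d‖²≡0 : ⟪ d , d ⟫ ≡ 0ℚ
    ‖d‖²≡0 = begin
      ⟪ d , d ⟫
        ≡⟨ Σℚ-cong (λ x → trans (Σℚ-cong λ y → expand c (h x y) (g x y)) (Σℚ-linear (c + c) (c * c) (λ y → h x y * h x y) (λ y → g x y * h x y) (λ y → g x y * g x y))) ⟩
      Σℚ (λ x → (Σℚ (λ y → h x y * h x y) - (c + c) * Σℚ (λ y → g x y * h x y))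
                 + c * c * Σℚ (λ y → g x y * g x y))
        ≡⟨ Σℚ-linear (c + c) (c * c) (λ x → Σℚ (λ y → h x y * h x y)) (λ x → Σℚ (λ y → g x y * h x y))
                                      (λ x → Σℚ (λ y → g x y * g x y)) ⟩
      (⟪ h , h ⟫ - (c + c) * ⟪ g , h ⟫) + c * c * ⟪ g , g ⟫
        ≡⟨ cong₂ (λ p q → (p - (c + c) * q) + c * c * ⟪ g , g ⟫) ⟪h,h⟫≡K ⟪g,h⟫≡cK ⟩
      (K - (c + c) * (c * K)) + c * c * ⟪ g , g ⟫
        ≡⟨ cong (λ p → (K - (c + c) * (c * K)) + c * c * p) ⟪g,g⟫≡K ⟩
      (K - (c + c) * (c * K)) + c * c * K
        ≡⟨ collect K c ⟩
      K - c * c * K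
        ≡⟨ cong (λ p → K - p * K) c²≡1 ⟩
      K - 1ℚ * K
        ≡⟨ cancel K ⟩
      0ℚ ∎
      where
      open ≡-Reasoning
      collect : ∀ K c → (K - (c + c) * (c * K)) + c * c * K ≡ K - c * c * K
      collect = solve-∀ ℚ-ring
      cancel : ∀ K → K - 1ℚ * K ≡ 0ℚ
      cancel = solve-∀ ℚ-ring

[b]-idem : ∀ b q → [ b ]ℚ * ([ b ]ℚ * q) ≡ [ b ]ℚ * q
[b]-idem true  q = *-identityˡ (1ℚ * q)
[b]-idem false q = trans (*-zeroˡ (0ℚ * q)) (sym (*-zeroˡ q))

[b]-absorb : ∀ b m f → [ b ]ℚ * (([ b ]ℚ * m + [ b ]ℚ * m) - f) ≡ [ b ]ℚ * ((m + m) - f)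
[b]-absorb true  = solve-∀ ℚ-ring
[b]-absorb false = solve-∀ ℚ-ring

[b]-absorbʳ : ∀ b p q → [ b ]ℚ * (p - [ b ]ℚ * q) ≡ [ b ]ℚ * (p - q)
[b]-absorbʳ true  = solve-∀ ℚ-ring
[b]-absorbʳ false = solve-∀ ℚ-ring

reflection-preserves-norm : ∀ {k} (b : Fin k → Bool) (g : Fin k → ℚ) κ → κ * Σℚ (λ i → [ b i ]ℚ) ≡ 1ℚ →
  let m = κ * Σℚ (λ i → [ b i ]ℚ * g i) in
  Σℚ (λ i → ([ b i ]ℚ * ((m + m) - g i)) * ([ b i ]ℚ * ((m + m) - g i)))
    ≡ Σℚ (λ i → ([ b i ]ℚ * g i) * ([ b i ]ℚ * g i))
reflection-preserves-norm {k} b g κ κD≡1 = begin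
  Σℚ (λ i → ([ b i ]ℚ * (2m - g i)) * ([ b i ]ℚ * (2m - g i)))
    ≡⟨ Σℚ-cong (λ i → expand (b i) m (g i)) ⟩
  Σℚ (λ i → ([ b i ]ℚ * (2m * 2m) - bg i * (2m + 2m)) + bg i * bg i)
    ≡⟨ Σℚ-distrib-+ (λ i → [ b i ]ℚ * (2m * 2m) - bg i * (2m + 2m)) (λ i → bg i * bg i) ⟩
  Σℚ (λ i → [ b i ]ℚ * (2m * 2m) - bg i * (2m + 2m)) + Σℚ (λ i → bg i * bg i)
    ≡⟨ cong (_+ Σℚ (λ i → bg i * bg i)) cross-terms-vanish ⟩
  0ℚ + Σℚ (λ i → bg i * bg i)
    ≡⟨ +-identityˡ _ ⟩
  Σℚ (λ i → bg i * bg i) ∎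
  where
  open ≡-Reasoning
  D = Σℚ (λ i → [ b i ]ℚ)
  M = Σℚ (λ i → [ b i ]ℚ * g i)
  m = κ * M
  2m = m + m
  bg : Fin k → ℚ
  bg i = [ b i ]ℚ * g i
  expand : ∀ b m g → ([ b ]ℚ * ((m + m) - g)) * ([ b ]ℚ * ((m + m) - g))
                   ≡ ([ b ]ℚ * ((m + m) * (m + m)) - ([ b ]ℚ * g) * ((m + m) + (m + m))) + ([ b ]ℚ * g) * ([ b ]ℚ * g)
  expand true  = solve-∀ ℚ-ring
  expand false = solve-∀ ℚ-ring
  factor : ∀ D κ M → D * ((κ * M + κ * M) * (κ * M + κ * M)) - M * ((κ * M + κ * M) + (κ * M + κ * M))
                   ≡ (κ * D - 1ℚ) * (κ * M * M + κ * M * M + κ * M * M + κ * M * M)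
  factor = solve-∀ ℚ-ring
  vanish : ∀ X → (1ℚ - 1ℚ) * X ≡ 0ℚ
  vanish = solve-∀ ℚ-ring
  cross-terms-vanish : Σℚ (λ i → [ b i ]ℚ * (2m * 2m) - bg i * (2m + 2m)) ≡ 0ℚ
  cross-terms-vanish = begin
    Σℚ (λ i → [ b i ]ℚ * (2m * 2m) - bg i * (2m + 2m))
      ≡⟨ Σℚ-distrib-- (λ i → [ b i ]ℚ * (2m * 2m)) (λ i → bg i * (2m + 2m)) ⟩
    Σℚ (λ i → [ b i ]ℚ * (2m * 2m)) - Σℚ (λ i → bg i * (2m + 2m))
      ≡⟨ cong₂ _-_ (*-distribʳ-Σℚ (2m * 2m) (λ i → [ b i ]ℚ)) (*-distribʳ-Σℚ (2m + 2m) bg) ⟨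
    D * (2m * 2m) - M * (2m + 2m)
      ≡⟨ factor D κ M ⟩
    (κ * D - 1ℚ) * (m * M + m * M + m * M + m * M)
      ≡⟨ cong (λ p → (p - 1ℚ) * (m * M + m * M + m * M + m * M)) κD≡1 ⟩
    (1ℚ - 1ℚ) * (m * M + m * M + m * M + m * M)
      ≡⟨ vanish (m * M + m * M + m * M + m * M) ⟩
    0ℚ ∎

module GroverWalk {n : ℕ} (G : Graph n) where
  open Graph G

  a : Fin n → Fin n → ℚ
  a = adjMat G

  a-sym : ∀ x y → a x y ≡ a y x
  a-sym x y = cong [_]ℚ (symmetric x y)

  degℚ : Fin n → ℚ
  degℚ x = (ℤ.+ deg G x) / 1

  κ : Fin n → ℚ
  κ x = inv (deg G x)

  Σa≡degℚ : ∀ x → Σℚ (λ z → a z x) ≡ degℚ x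
  Σa≡degℚ x = trans (Σℚ-cong (λ z → a-sym z x)) (Σℚ[]≡Σℕ[] (adj x))

  κ*degℚ≡1 : ∀ x → κ x * degℚ x ≡ 1ℚ
  κ*degℚ≡1 x with Σℕ[]-pos (adj x) (proj₁ (noIsolated x)) (proj₂ (noIsolated x))
  ... | m , deg≡1+m = subst (λ k → inv k * ((ℤ.+ k) / 1) ≡ 1ℚ) (sym deg≡1+m) (inv-suc m)

  -- In the paper's notation, incoming f = √D · N f and mean f = √D⁻¹ · N f.
  incoming : ArcVec G → Fin n → ℚ
  incoming f y = Σℚ λ z → a z y * f z y

  outgoing : ArcVec G → Fin n → ℚ
  outgoing f y = Σℚ λ z → a y z * f y z

  mean : ArcVec G → Fin n → ℚ
  mean f y = κ y * incoming f y

  incoming-cong : ∀ {f g} → f ≈ g → ∀ y → incoming f y ≡ incoming g y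
  incoming-cong f≈g y = Σℚ-cong λ z → cong (a z y *_) (f≈g z y)

  incoming-scale : ∀ c f y → incoming (scale c f) y ≡ c * incoming f y
  incoming-scale c f y = trans (Σℚ-cong λ z → swap (a z y) c (f z y)) (sym (*-distribˡ-Σℚ c (λ z → a z y * f z y)))
    where
    swap : ∀ p q r → p * (q * r) ≡ q * (p * r)
    swap = solve-∀ ℚ-ring

  incoming-onArcs : ∀ f y → incoming (onArcs G f) y ≡ incoming f y
  incoming-onArcs f y = Σℚ-cong λ z → [b]-idem (adj z y) (f z y)

  U-apply : ∀ f x y → U G f x y ≡ a x y * ((mean f x + mean f x) - f y x)
  U-apply f x y = begin
    a x y * (a y x * ((a y x * mean f x + a y x * mean f x) - f y x))
      ≡⟨ cong (a x y *_) ([b]-absorb (adj y x) (mean f x) (f y x)) ⟩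
    a x y * (a y x * ((mean f x + mean f x) - f y x))
      ≡⟨ cong (λ b → a x y * (b * ((mean f x + mean f x) - f y x))) (a-sym y x) ⟩
    a x y * (a x y * ((mean f x + mean f x) - f y x))
      ≡⟨ [b]-idem (adj x y) _ ⟩
    a x y * ((mean f x + mean f x) - f y x) ∎
    where open ≡-Reasoning

  mean-cong : ∀ {f g} → f ≈ g → ∀ x → mean f x ≡ mean g x
  mean-cong f≈g x = cong (κ x *_) (incoming-cong f≈g x)

  U-cong : ∀ {f g} → f ≈ g → U G f ≈ U G g
  U-cong {f} {g} f≈g x y = begin
    U G f x y                                  ≡⟨ U-apply f x y ⟩
    a x y * ((mean f x + mean f x) - f y x)    ≡⟨ cong₂ (λ m h → a x y * ((m + m) - h)) (mean-cong f≈g x) (f≈g y x) ⟩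
    a x y * ((mean g x + mean g x) - g y x)    ≡⟨ U-apply g x y ⟨
    U G g x y                                  ∎
    where open ≡-Reasoning

  U-onArcs : ∀ f → U G (onArcs G f) ≈ U G f
  U-onArcs f x y = begin
    U G (onArcs G f) x y                                  ≡⟨ U-apply (onArcs G f) x y ⟩
    a x y * ((mean (onArcs G f) x + mean (onArcs G f) x) - a y x * f y x)
      ≡⟨ cong₂ (λ m b → a x y * ((m + m) - b * f y x)) (cong (κ x *_) (incoming-onArcs f x)) (a-sym y x) ⟩
    a x y * ((mean f x + mean f x) - a x y * f y x)       ≡⟨ [b]-absorbʳ (adj x y) (mean f x + mean f x) (f y x) ⟩
    a x y * ((mean f x + mean f x) - f y x)               ≡⟨ U-apply f x y ⟨
    U G f x y                                             ∎
    where open ≡-Reasoning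

  U-scale : ∀ c f → U G (scale c f) ≈ scale c (U G f)
  U-scale c f x y = begin
    U G (scale c f) x y
      ≡⟨ U-apply (scale c f) x y ⟩
    a x y * ((mean (scale c f) x + mean (scale c f) x) - c * f y x)
      ≡⟨ cong (λ m → a x y * ((m + m) - c * f y x)) (cong (κ x *_) (incoming-scale c f x)) ⟩
    a x y * ((κ x * (c * incoming f x) + κ x * (c * incoming f x)) - c * f y x)
      ≡⟨ pull-out (a x y) (κ x) c (incoming f x) (f y x) ⟩
    c * (a x y * ((mean f x + mean f x) - f y x))
      ≡⟨ cong (c *_) (U-apply f x y) ⟨
    c * U G f x y ∎
    where
    open ≡-Reasoning
    pull-out : ∀ b k c i h → b * ((k * (c * i) + k * (c * i)) - c * h) ≡ c * (b * ((k * i + k * i) - h))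
    pull-out = solve-∀ ℚ-ring

  onArcs-U : ∀ f → onArcs G (U G f) ≈ U G f
  onArcs-U f x y = [b]-idem (adj x y) _

  onArcs-Upow : ∀ t f → onArcs G (Upow G t f) ≈ Upow G t f
  onArcs-Upow zero    f x y = [b]-idem (adj x y) (f x y)
  onArcs-Upow (suc t) f     = onArcs-U (Upow G t f)

  Upow-cong : ∀ t {f g} → f ≈ g → Upow G t f ≈ Upow G t g
  Upow-cong zero    f≈g x y = cong (a x y *_) (f≈g x y)
  Upow-cong (suc t) f≈g     = U-cong (Upow-cong t f≈g)

  Upow-scale : ∀ t c f → Upow G t (scale c f) ≈ scale c (Upow G t f)
  Upow-scale zero    c f x y = swap (a x y) c (f x y)
    where
    swap : ∀ p q r → p * (q * r) ≡ q * (p * r)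
    swap = solve-∀ ℚ-ring
  Upow-scale (suc t) c f x y = trans (U-cong (Upow-scale t c f) x y) (U-scale c (Upow G t f) x y)

  Upow-+ : ∀ s t f → Upow G (s ℕ.+ t) f ≈ Upow G s (Upow G t f)
  Upow-+ zero    t f x y = sym (onArcs-Upow t f x y)
  Upow-+ (suc s) t f     = U-cong (Upow-+ s t f)

  incoming-U : ∀ f y → incoming (U G f) y
                       ≡ (Σℚ (λ z → a y z * mean f z) + Σℚ (λ z → a y z * mean f z)) - outgoing f y
  incoming-U f y = begin
    Σℚ (λ z → a z y * U G f z y)
      ≡⟨ Σℚ-cong (λ z → cong (a z y *_) (U-apply f z y)) ⟩
    Σℚ (λ z → a z y * (a z y * ((mean f z + mean f z) - f y z)))
      ≡⟨ Σℚ-cong (λ z → trans ([b]-idem (adj z y) _) (cong (_* ((mean f z + mean f z) - f y z)) (a-sym z y))) ⟩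
    Σℚ (λ z → a y z * ((mean f z + mean f z) - f y z))
      ≡⟨ Σℚ-cong (λ z → distribute (a y z) (mean f z) (f y z)) ⟩
    Σℚ (λ z → (am z + am z) - a y z * f y z)
      ≡⟨ Σℚ-distrib-- (λ z → am z + am z) (λ z → a y z * f y z) ⟩
    Σℚ (λ z → am z + am z) - outgoing f y
      ≡⟨ cong (_- outgoing f y) (Σℚ-distrib-+ am am) ⟩
    (Σℚ am + Σℚ am) - outgoing f y ∎
    where
    open ≡-Reasoning
    am : Fin n → ℚ
    am z = a y z * mean f z
    distribute : ∀ b m h → b * ((m + m) - h) ≡ (b * m + b * m) - b * h
    distribute = solve-∀ ℚ-ring

  outgoing-U : ∀ f y → outgoing (U G f) y ≡ incoming f y
  outgoing-U f y = begin
    Σℚ (λ z → a y z * U G f y z)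
      ≡⟨ Σℚ-cong (λ z → cong (a y z *_) (U-apply f y z)) ⟩
    Σℚ (λ z → a y z * (a y z * (2m - f z y)))
      ≡⟨ Σℚ-cong (λ z → trans ([b]-idem (adj y z) _) (cong (_* (2m - f z y)) (a-sym y z))) ⟩
    Σℚ (λ z → a z y * (2m - f z y))
      ≡⟨ Σℚ-cong (λ z → distribute (a z y) 2m (f z y)) ⟩
    Σℚ (λ z → a z y * 2m - a z y * f z y)
      ≡⟨ Σℚ-distrib-- (λ z → a z y * 2m) (λ z → a z y * f z y) ⟩
    Σℚ (λ z → a z y * 2m) - incoming f y
      ≡⟨ cong (_- incoming f y) (trans (sym (*-distribʳ-Σℚ 2m (λ z → a z y))) (cong (_* 2m) (Σa≡degℚ y))) ⟩
    degℚ y * (κ y * incoming f y + κ y * incoming f y) - incoming f y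
      ≡⟨ regroup (degℚ y) (κ y) (incoming f y) ⟩
    (κ y * degℚ y) * (incoming f y + incoming f y) - incoming f y
      ≡⟨ cong (λ p → p * (incoming f y + incoming f y) - incoming f y) (κ*degℚ≡1 y) ⟩
    1ℚ * (incoming f y + incoming f y) - incoming f y
      ≡⟨ cancel (incoming f y) ⟩
    incoming f y ∎
    where
    open ≡-Reasoning
    2m = mean f y + mean f y
    distribute : ∀ b p q → b * (p - q) ≡ b * p - b * q
    distribute = solve-∀ ℚ-ring
    regroup : ∀ d k i → d * (k * i + k * i) - i ≡ (k * d) * (i + i) - i
    regroup = solve-∀ ℚ-ring
    cancel : ∀ i → 1ℚ * (i + i) - i ≡ i
    cancel = solve-∀ ℚ-ring

  incoming-χ : ∀ x y → incoming (χ G x) y ≡ degℚ y * δ y x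
  incoming-χ x y = begin
    Σℚ (λ z → a z y * (a z y * δ y x))   ≡⟨ Σℚ-cong (λ z → [b]-idem (adj z y) (δ y x)) ⟩
    Σℚ (λ z → a z y * δ y x)             ≡⟨ *-distribʳ-Σℚ (δ y x) (λ z → a z y) ⟨
    Σℚ (λ z → a z y) * δ y x             ≡⟨ cong (_* δ y x) (Σa≡degℚ y) ⟩
    degℚ y * δ y x                       ∎
    where open ≡-Reasoning

  outgoing-χ : ∀ x y → outgoing (χ G x) y ≡ a y x
  outgoing-χ x y = trans (Σℚ-cong λ z → [b]-idem (adj y z) (δ z x)) (Σℚ-*δ (a y) x)

  mean-χ : ∀ x y → mean (χ G x) y ≡ δ y x
  mean-χ x y = begin
    κ y * incoming (χ G x) y   ≡⟨ cong (κ y *_) (incoming-χ x y) ⟩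
    κ y * (degℚ y * δ y x)     ≡⟨ *-assoc (κ y) (degℚ y) (δ y x) ⟨
    κ y * degℚ y * δ y x       ≡⟨ cong (_* δ y x) (κ*degℚ≡1 y) ⟩
    1ℚ * δ y x                 ≡⟨ *-identityˡ (δ y x) ⟩
    δ y x                      ∎
    where open ≡-Reasoning

  incoming-Uχ : ∀ x y → incoming (U G (χ G x)) y ≡ a y x
  incoming-Uχ x y = begin
    incoming (U G (χ G x)) y
      ≡⟨ incoming-U (χ G x) y ⟩
    (Σℚ (λ z → a y z * mean (χ G x) z) + Σℚ (λ z → a y z * mean (χ G x) z)) - outgoing (χ G x) y
      ≡⟨ cong₂ (λ p q → (p + p) - q) (trans (Σℚ-cong λ z → cong (a y z *_) (mean-χ x z)) (Σℚ-*δ (a y) x)) (outgoing-χ x y) ⟩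
    (a y x + a y x) - a y x
      ≡⟨ cancel (a y x) ⟩
    a y x ∎
    where
    open ≡-Reasoning
    cancel : ∀ p → (p + p) - p ≡ p
    cancel = solve-∀ ℚ-ring

  ⟪χ,f⟫≡incoming : ∀ y f → ⟪ χ G y , f ⟫ ≡ incoming f y
  ⟪χ,f⟫≡incoming y f = Σℚ-cong λ z → trans (Σℚ-cong λ w → swap (a z w) (δ w y) (f z w)) (Σℚ-*δ (λ w → a z w * f z w) y)
    where
    swap : ∀ p d q → p * d * q ≡ p * q * d
    swap = solve-∀ ℚ-ring

  ⟪χ,χ⟫≡degℚ : ∀ x → ⟪ χ G x , χ G x ⟫ ≡ degℚ x
  ⟪χ,χ⟫≡degℚ x = begin
    ⟪ χ G x , χ G x ⟫     ≡⟨ ⟪χ,f⟫≡incoming x (χ G x) ⟩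
    incoming (χ G x) x    ≡⟨ incoming-χ x x ⟩
    degℚ x * δ x x        ≡⟨ cong (degℚ x *_) (δ-refl x) ⟩
    degℚ x * 1ℚ           ≡⟨ *-identityʳ (degℚ x) ⟩
    degℚ x                ∎
    where open ≡-Reasoning

  U-preserves-norm : ∀ f → ⟪ U G f , U G f ⟫ ≡ ⟪ onArcs G f , onArcs G f ⟫
  U-preserves-norm f = begin
    ⟪ U G f , U G f ⟫
      ≡⟨ ⟪⟫-cong reflected reflected ⟩
    Σℚ (λ x → Σℚ (λ y → (a y x * ((mean f x + mean f x) - f y x)) * (a y x * ((mean f x + mean f x) - f y x))))
      ≡⟨ Σℚ-cong (λ x → reflection-preserves-norm (λ y → adj y x) (λ y → f y x) (κ x)
                          (trans (cong (κ x *_) (Σa≡degℚ x)) (κ*degℚ≡1 x))) ⟩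
    Σℚ (λ x → Σℚ (λ y → (a y x * f y x) * (a y x * f y x)))
      ≡⟨ Σℚ-comm (λ x y → (a y x * f y x) * (a y x * f y x)) ⟩
    ⟪ onArcs G f , onArcs G f ⟫ ∎
    where
    open ≡-Reasoning
    reflected : U G f ≈ λ x y → a y x * ((mean f x + mean f x) - f y x)
    reflected x y = trans (U-apply f x y) (cong (_* ((mean f x + mean f x) - f y x)) (a-sym x y))

  Upow-preserves-norm : ∀ t f → ⟪ Upow G t f , Upow G t f ⟫ ≡ ⟪ onArcs G f , onArcs G f ⟫
  Upow-preserves-norm zero    f = refl
  Upow-preserves-norm (suc t) f = begin
    ⟪ U G (Upow G t f) , U G (Upow G t f) ⟫                ≡⟨ U-preserves-norm (Upow G t f) ⟩
    ⟪ onArcs G (Upow G t f) , onArcs G (Upow G t f) ⟫      ≡⟨ ⟪⟫-cong (onArcs-Upow t f) (onArcs-Upow t f) ⟩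
    ⟪ Upow G t f , Upow G t f ⟫                            ≡⟨ Upow-preserves-norm t f ⟩
    ⟪ onArcs G f , onArcs G f ⟫                            ∎
    where open ≡-Reasoning

  onArcs-χ : ∀ x → onArcs G (χ G x) ≈ χ G x
  onArcs-χ x p q = [b]-idem (adj p q) (δ q x)

  walkMatrix : ℕ → Fin n → Fin n → ℚ
  walkMatrix t y x = incoming (Upow G t (χ G x)) y

  walkMatrix-of-transfer : ∀ {t x z} c → Upow G t (χ G x) ≈ scale c (χ G z) →
                           ∀ y → walkMatrix t y x ≡ c * (degℚ y * δ y z)
  walkMatrix-of-transfer {t} {x} {z} c Uχ≈cχ y = begin
    incoming (Upow G t (χ G x)) y    ≡⟨ incoming-cong Uχ≈cχ y ⟩
    incoming (scale c (χ G z)) y     ≡⟨ incoming-scale c (χ G z) y ⟩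
    c * incoming (χ G z) y           ≡⟨ cong (c *_) (incoming-χ z y) ⟩
    c * (degℚ y * δ y z)             ∎
    where open ≡-Reasoning

  walkMatrix-at-target : ∀ {t x z} c → Upow G t (χ G x) ≈ scale c (χ G z) → walkMatrix t z x ≡ c * degℚ z
  walkMatrix-at-target {t} {x} {z} c Uχ≈cχ = begin
    walkMatrix t z x           ≡⟨ walkMatrix-of-transfer {t} {x} {z} c Uχ≈cχ z ⟩
    c * (degℚ z * δ z z)       ≡⟨ cong (λ e → c * (degℚ z * e)) (δ-refl z) ⟩
    c * (degℚ z * 1ℚ)          ≡⟨ cong (c *_) (*-identityʳ (degℚ z)) ⟩
    c * degℚ z                 ∎
    where open ≡-Reasoning

  c*degℚ≢0 : ∀ {c} y → c * c ≡ 1ℚ → c * degℚ y ≢ 0ℚ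
  c*degℚ≢0 {c} y c²≡1 = *≡1⇒≢0 (begin
    (c * degℚ y) * (c * κ y)   ≡⟨ regroup c (degℚ y) (κ y) ⟩
    (c * c) * (κ y * degℚ y)   ≡⟨ cong₂ _*_ c²≡1 (κ*degℚ≡1 y) ⟩
    1ℚ * 1ℚ                    ≡⟨⟩
    1ℚ                         ∎)
    where
    open ≡-Reasoning
    regroup : ∀ c D k → (c * D) * (c * k) ≡ (c * c) * (k * D)
    regroup = solve-∀ ℚ-ring

  walkMatrix-support : ∀ {t x y z} c → Upow G t (χ G x) ≈ scale c (χ G z) → walkMatrix t y x ≢ 0ℚ → y ≡ z
  walkMatrix-support {t} {x} {y} {z} c Uχ≈cχ W≢0 = δ≢0⇒≡ λ δ≡0 → W≢0 (begin
    walkMatrix t y x           ≡⟨ walkMatrix-of-transfer {t} {x} {z} c Uχ≈cχ y ⟩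
    c * (degℚ y * δ y z)       ≡⟨ cong (λ e → c * (degℚ y * e)) δ≡0 ⟩
    c * (degℚ y * 0ℚ)          ≡⟨ annihilate c (degℚ y) ⟩
    0ℚ                         ∎)
    where
    open ≡-Reasoning
    annihilate : ∀ p q → p * (q * 0ℚ) ≡ 0ℚ
    annihilate = solve-∀ ℚ-ring

  Transfer : ℕ → (Fin n → Fin n) → Set
  Transfer t π = ∀ x → ∃ λ c → c * c ≡ 1ℚ × Upow G t (χ G x) ≈ scale c (χ G (π x))

  χ-injective : ∀ {c c′ x y} → c ≢ 0ℚ → scale c (χ G x) ≈ scale c′ (χ G y) → x ≡ y
  χ-injective {c} {c′} {x} {y} c≢0 cχx≈c′χy = δ≢0⇒≡ λ δxy≡0 → c≢0 (begin
    c                       ≡⟨ *-identityʳ c ⟨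
    c * (1ℚ * 1ℚ)           ≡⟨ cong₂ (λ p q → c * (p * q)) azx≡1 (δ-refl x) ⟨
    c * (a z x * δ x x)     ≡⟨ cχx≈c′χy z x ⟩
    c′ * (a z x * δ x y)    ≡⟨ cong (λ d → c′ * (a z x * d)) δxy≡0 ⟩
    c′ * (a z x * 0ℚ)       ≡⟨ annihilate c′ (a z x) ⟩
    0ℚ                      ∎)
    where
    open ≡-Reasoning
    z = proj₁ (noIsolated x)
    azx≡1 : a z x ≡ 1ℚ
    azx≡1 = cong [_]ℚ (trans (symmetric z x) (proj₂ (noIsolated x)))
    annihilate : ∀ p q → p * (q * 0ℚ) ≡ 0ℚ
    annihilate = solve-∀ ℚ-ring

  transfer-zero : ∀ {π} → Transfer 0 π → ∀ x → π x ≡ x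
  transfer-zero T x with T x
  ... | c , _ , χx≈cχπx = sym (χ-injective {1ℚ} {c} 1≢0 λ p q → trans (*-identityˡ _) (trans (sym ([b]-idem (adj p q) (δ q x))) (χx≈cχπx p q)))

  transfer-functional : ∀ {t π π′} → Transfer t π → Transfer t π′ → ∀ x → π x ≡ π′ x
  transfer-functional T T′ x with T x | T′ x
  ... | c , c²≡1 , Uχ≈cχπx | c′ , _ , Uχ≈c′χπ′x =
    χ-injective {c} {c′} (*≡1⇒≢0 c²≡1) λ p q → trans (sym (Uχ≈cχπx p q)) (Uχ≈c′χπ′x p q)

  transfer-difference : ∀ {s t π π′} → s ℕ.≤ t → (∀ x → π (π x) ≡ x) →
                        Transfer s π → Transfer t π′ → Transfer (t ℕ.∸ s) (π′ ∘ π)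
  transfer-difference {s} {t} {π} {π′} s≤t π-involutive T T′ x with T (π x) | T′ (π x)
  ... | c , c²≡1 , Usχ≈cχ | c′ , c′²≡1 , Utχ≈c′χ = c * c′ , square-product {c} {c′} c²≡1 c′²≡1 , λ p q →
    subst (λ z → Upow G (t ℕ.∸ s) (χ G z) p q ≡ c * c′ * χ G (π′ y) p q) (π-involutive x) (walk p q)
    where
    open ≡-Reasoning
    y = π x
    χπy≈cUsχy : χ G (π y) ≈ scale c (Upow G s (χ G y))
    χπy≈cUsχy p q = begin
      χ G (π y) p q                   ≡⟨ *-identityˡ _ ⟨
      1ℚ * χ G (π y) p q              ≡⟨ cong (_* χ G (π y) p q) c²≡1 ⟨
      c * c * χ G (π y) p q           ≡⟨ *-assoc c c _ ⟩
      c * (c * χ G (π y) p q)         ≡⟨ cong (c *_) (Usχ≈cχ p q) ⟨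
      c * Upow G s (χ G y) p q        ∎
    walk : Upow G (t ℕ.∸ s) (χ G (π y)) ≈ scale (c * c′) (χ G (π′ y))
    walk p q = begin
      Upow G (t ℕ.∸ s) (χ G (π y)) p q
        ≡⟨ Upow-cong (t ℕ.∸ s) χπy≈cUsχy p q ⟩
      Upow G (t ℕ.∸ s) (scale c (Upow G s (χ G y))) p q
        ≡⟨ Upow-scale (t ℕ.∸ s) c _ p q ⟩
      c * Upow G (t ℕ.∸ s) (Upow G s (χ G y)) p q
        ≡⟨ cong (c *_) (Upow-+ (t ℕ.∸ s) s (χ G y) p q) ⟨
      c * Upow G (t ℕ.∸ s ℕ.+ s) (χ G y) p q
        ≡⟨ cong (λ r → c * Upow G r (χ G y) p q) (ℕ.m∸n+n≡m s≤t) ⟩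
      c * Upow G t (χ G y) p q
        ≡⟨ cong (c *_) (Utχ≈c′χ p q) ⟩
      c * (c′ * χ G (π′ y) p q)
        ≡⟨ *-assoc c c′ _ ⟨
      c * c′ * χ G (π′ y) p q ∎

-- Transfer maps and Euclid's algorithm

module TransferTimes {A : Set} (T : ℕ → (A → A) → Set)
  (T-zero        : ∀ {π} → T 0 π → ∀ x → π x ≡ x)
  (T-functional  : ∀ {t π π′} → T t π → T t π′ → ∀ x → π x ≡ π′ x)
  (T-involutive  : ∀ {t π} → T t π → ∀ x → π (π x) ≡ x)
  (T-difference  : ∀ {s t π π′} → s ℕ.≤ t → T s π → T t π′ → T (t ℕ.∸ s) (π′ ∘ π))
  where

  TrivialOrEqual : (A → A) → (A → A) → Set
  TrivialOrEqual π π′ = (∀ x → π x ≡ x) ⊎ (∀ x → π′ x ≡ x) ⊎ (∀ x → π x ≡ π′ x)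

  trivialOrEqual-sym : ∀ {π π′} → TrivialOrEqual π π′ → TrivialOrEqual π′ π
  trivialOrEqual-sym (inj₁ π≗id)        = inj₂ (inj₁ π≗id)
  trivialOrEqual-sym (inj₂ (inj₁ π′≗id)) = inj₁ π′≗id
  trivialOrEqual-sym (inj₂ (inj₂ π≗π′))  = inj₂ (inj₂ (sym ∘ π≗π′))

  trivialOrEqual-difference : ∀ {π π′} → (∀ x → π (π x) ≡ x) → (∀ x → π′ (π′ x) ≡ x) →
                              TrivialOrEqual π (π′ ∘ π) → TrivialOrEqual π π′
  trivialOrEqual-difference         _      _       (inj₁ π≗id)         = inj₁ π≗id
  trivialOrEqual-difference {π} {π′} _      π′-inv (inj₂ (inj₁ π′π≗id)) =
    inj₂ (inj₂ λ x → trans (sym (π′-inv (π x))) (cong π′ (π′π≗id x)))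
  trivialOrEqual-difference {π} {π′} π-inv _      (inj₂ (inj₂ π≗π′π))  =
    inj₂ (inj₁ λ x → trans (cong π′ (sym (π-inv x))) (trans (sym (π≗π′π (π x))) (π-inv x)))

  trivialOrEqual-acc : ∀ {s t π π′} → Acc ℕ._<_ (s ℕ.+ t) → T s π → T t π′ → TrivialOrEqual π π′
  trivialOrEqual-acc {zero}            _         Ts _  = inj₁ (T-zero Ts)
  trivialOrEqual-acc {suc s} {zero}    _         _  Tt = inj₂ (inj₁ (T-zero Tt))
  trivialOrEqual-acc {suc s} {suc t}   (acc rec) Ts Tt with ℕ.<-cmp s t
  ... | tri≈ _ refl _ = inj₂ (inj₂ (T-functional Ts Tt))
  ... | tri< s<t _ _  =
    trivialOrEqual-difference (T-involutive Ts) (T-involutive Tt)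
      (trivialOrEqual-acc (rec shorter) Ts (T-difference (ℕ.s≤s (ℕ.<⇒≤ s<t)) Ts Tt))
    where
    shorter : suc s ℕ.+ (t ℕ.∸ s) ℕ.< suc s ℕ.+ suc t
    shorter = subst (ℕ._< suc s ℕ.+ suc t) (cong suc (sym (ℕ.m+[n∸m]≡n (ℕ.<⇒≤ s<t)))) (ℕ.m<n+m (suc t) ℕ.z<s)
  ... | tri> _ _ t<s  =
    trivialOrEqual-sym (trivialOrEqual-difference (T-involutive Tt) (T-involutive Ts)
      (trivialOrEqual-acc (rec shorter) Tt (T-difference (ℕ.s≤s (ℕ.<⇒≤ t<s)) Tt Ts)))
    where
    shorter : suc t ℕ.+ (s ℕ.∸ t) ℕ.< suc s ℕ.+ suc t
    shorter = subst (ℕ._< suc s ℕ.+ suc t) (cong suc (sym (ℕ.m+[n∸m]≡n (ℕ.<⇒≤ t<s)))) (ℕ.m<m+n (suc s) ℕ.z<s)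

  trivialOrEqual : ∀ {s t π π′} → T s π → T t π′ → TrivialOrEqual π π′
  trivialOrEqual = trivialOrEqual-acc (<-wellFounded _)

-- The Bose–Mesner algebra

module BoseMesner {n d : ℕ} (𝒜 : AssociationScheme n d) where
  open AssociationScheme 𝒜

  Coefficients : Set
  Coefficients = Fin (suc d) → ℚ

  ⟦_⟧ : Coefficients → Fin n → Fin n → ℚ
  ⟦ β ⟧ x y = Σℚ λ k → β k * A k x y

  ⟦⟧-sym : ∀ β x y → ⟦ β ⟧ x y ≡ ⟦ β ⟧ y x
  ⟦⟧-sym β x y = Σℚ-cong λ k → cong (β k *_) (symm k x y)

  ⟦⟧-scale : ∀ p β x y → p * ⟦ β ⟧ x y ≡ ⟦ (λ k → p * β k) ⟧ x y
  ⟦⟧-scale p β x y = trans (*-distribˡ-Σℚ p (λ k → β k * A k x y)) (Σℚ-cong λ k → sym (*-assoc p (β k) (A k x y)))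

  ⟦⟧-Σ : ∀ {m} (γ : Fin m → Coefficients) x y → Σℚ (λ i → ⟦ γ i ⟧ x y) ≡ ⟦ (λ k → Σℚ (λ i → γ i k)) ⟧ x y
  ⟦⟧-Σ γ x y = trans (Σℚ-comm (λ i k → γ i k * A k x y)) (Σℚ-cong λ k → sym (*-distribʳ-Σℚ (A k x y) (λ i → γ i k)))

  ⟦⟧-+ : ∀ α β x y → ⟦ α ⟧ x y + ⟦ β ⟧ x y ≡ ⟦ (λ k → α k + β k) ⟧ x y
  ⟦⟧-+ α β x y = trans (sym (Σℚ-distrib-+ (λ k → α k * A k x y) (λ k → β k * A k x y)))
                       (Σℚ-cong λ k → sym (*-distribʳ-+ (A k x y) (α k) (β k)))

  ⟦1⟧≡1 : ∀ x y → ⟦ (λ _ → 1ℚ) ⟧ x y ≡ 1ℚ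
  ⟦1⟧≡1 x y = trans (Σℚ-cong λ k → *-identityˡ (A k x y)) (sum≡J x y)

  ⟦δ⟧≡A : ∀ l x y → ⟦ (λ k → δ k l) ⟧ x y ≡ A l x y
  ⟦δ⟧≡A l x y = trans (Σℚ-cong λ k → *-comm (δ k l) (A k x y)) (Σℚ-*δ (λ k → A k x y) l)

  _⊛_ : Coefficients → Coefficients → Coefficients
  (α ⊛ β) m = Σℚ λ k → Σℚ λ l → α k * β l * proj₁ (closed k l) m

  ⟦⟧-* : ∀ α β x y → Σℚ (λ z → ⟦ α ⟧ x z * ⟦ β ⟧ z y) ≡ ⟦ α ⊛ β ⟧ x y
  ⟦⟧-* α β x y = begin
    Σℚ (λ z → ⟦ α ⟧ x z * ⟦ β ⟧ z y)
      ≡⟨ Σℚ-cong (λ z → Σℚ*Σℚ (λ k → α k * A k x z) (λ l → β l * A l z y)) ⟩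
    Σℚ (λ z → Σℚ (λ k → Σℚ (λ l → term k l z)))
      ≡⟨ trans (Σℚ-comm (λ z k → Σℚ (λ l → term k l z))) (Σℚ-cong λ k → Σℚ-comm (λ z l → term k l z)) ⟩
    Σℚ (λ k → Σℚ (λ l → Σℚ (λ z → term k l z)))
      ≡⟨ Σℚ-cong (λ k → Σℚ-cong λ l → trans (Σℚ-cong λ z → regroup (α k) (A k x z) (β l) (A l z y))
                                             (sym (*-distribˡ-Σℚ (α k * β l) (λ z → A k x z * A l z y)))) ⟩
    Σℚ (λ k → Σℚ (λ l → α k * β l * Σℚ (λ z → A k x z * A l z y)))
      ≡⟨ Σℚ-cong (λ k → Σℚ-cong λ l → cong (α k * β l *_) (proj₂ (closed k l) x y)) ⟩
    Σℚ (λ k → Σℚ (λ l → α k * β l * ⟦ proj₁ (closed k l) ⟧ x y))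
      ≡⟨ Σℚ-cong (λ k → Σℚ-cong λ l → ⟦⟧-scale (α k * β l) (proj₁ (closed k l)) x y) ⟩
    Σℚ (λ k → Σℚ (λ l → ⟦ (λ m → α k * β l * proj₁ (closed k l) m) ⟧ x y))
      ≡⟨ Σℚ-cong (λ k → ⟦⟧-Σ (λ l m → α k * β l * proj₁ (closed k l) m) x y) ⟩
    Σℚ (λ k → ⟦ (λ m → Σℚ (λ l → α k * β l * proj₁ (closed k l) m)) ⟧ x y)
      ≡⟨ ⟦⟧-Σ (λ k m → Σℚ (λ l → α k * β l * proj₁ (closed k l) m)) x y ⟩
    ⟦ α ⊛ β ⟧ x y ∎
    where
    open ≡-Reasoning
    term : Fin (suc d) → Fin (suc d) → Fin n → ℚ
    term k l z = α k * A k x z * (β l * A l z y)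
    regroup : ∀ p q r s → p * q * (r * s) ≡ p * r * (q * s)
    regroup = solve-∀ ℚ-ring

  ⟦⟧-*-comm : ∀ α β x y → Σℚ (λ z → ⟦ α ⟧ x z * ⟦ β ⟧ z y) ≡ Σℚ (λ z → ⟦ β ⟧ x z * ⟦ α ⟧ z y)
  ⟦⟧-*-comm α β x y = begin
    Σℚ (λ z → ⟦ α ⟧ x z * ⟦ β ⟧ z y)   ≡⟨ ⟦⟧-* α β x y ⟩
    ⟦ α ⊛ β ⟧ x y                      ≡⟨ ⟦⟧-sym (α ⊛ β) x y ⟩
    ⟦ α ⊛ β ⟧ y x                      ≡⟨ ⟦⟧-* α β y x ⟨
    Σℚ (λ z → ⟦ α ⟧ y z * ⟦ β ⟧ z x)   ≡⟨ Σℚ-cong (λ z → trans (*-comm (⟦ α ⟧ y z) _) (cong₂ _*_ (⟦⟧-sym β z x) (⟦⟧-sym α y z))) ⟩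
    Σℚ (λ z → ⟦ β ⟧ x z * ⟦ α ⟧ z y)   ∎
    where open ≡-Reasoning

  ⟦⟧-columnSum-const : ∀ β x x′ → Σℚ (λ z → ⟦ β ⟧ z x) ≡ Σℚ (λ z → ⟦ β ⟧ z x′)
  ⟦⟧-columnSum-const β x x′ = begin
    Σℚ (λ z → ⟦ β ⟧ z x)                        ≡⟨ Σℚ-cong (λ z → trans (sym (*-identityˡ _)) (cong (_* ⟦ β ⟧ z x) (sym (⟦1⟧≡1 x′ z)))) ⟩
    Σℚ (λ z → ⟦ (λ _ → 1ℚ) ⟧ x′ z * ⟦ β ⟧ z x)  ≡⟨ ⟦⟧-*-comm (λ _ → 1ℚ) β x′ x ⟩
    Σℚ (λ z → ⟦ β ⟧ x′ z * ⟦ (λ _ → 1ℚ) ⟧ z x)  ≡⟨ Σℚ-cong (λ z → trans (cong (⟦ β ⟧ x′ z *_) (⟦1⟧≡1 z x)) (*-identityʳ _)) ⟩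
    Σℚ (λ z → ⟦ β ⟧ x′ z)                       ≡⟨ Σℚ-cong (λ z → ⟦⟧-sym β x′ z) ⟩
    Σℚ (λ z → ⟦ β ⟧ z x′)                       ∎
    where open ≡-Reasoning

  A-columnSum-const : ∀ l x x′ → Σℚ (λ z → A l z x) ≡ Σℚ (λ z → A l z x′)
  A-columnSum-const l x x′ = begin
    Σℚ (λ z → A l z x)                    ≡⟨ Σℚ-cong (λ z → ⟦δ⟧≡A l z x) ⟨
    Σℚ (λ z → ⟦ (λ k → δ k l) ⟧ z x)      ≡⟨ ⟦⟧-columnSum-const (λ k → δ k l) x x′ ⟩
    Σℚ (λ z → ⟦ (λ k → δ k l) ⟧ z x′)     ≡⟨ Σℚ-cong (λ z → ⟦δ⟧≡A l z x′) ⟩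
    Σℚ (λ z → A l z x′)                   ∎
    where open ≡-Reasoning

  A-nonneg : ∀ k x y → 0ℚ ≤ A k x y
  A-nonneg k x y with zeroOne k x y
  ... | inj₁ A≡0 = ≤-reflexive (sym A≡0)
  ... | inj₂ A≡1 = subst (0ℚ ≤_) (sym A≡1) (nonNegative⁻¹ 1ℚ)

  A≢0⇒A≡1 : ∀ {k x y} → A k x y ≢ 0ℚ → A k x y ≡ 1ℚ
  A≢0⇒A≡1 {k} {x} {y} A≢0 with zeroOne k x y
  ... | inj₁ A≡0 = ⊥-elim (A≢0 A≡0)
  ... | inj₂ A≡1 = A≡1

  class : ∀ x y → ∃ λ k → A k x y ≡ 1ℚ
  class x y = map₂ A≢0⇒A≡1 (Σℚ≢0⇒∃≢0 (λ k → A k x y) (λ ΣA≡0 → 1≢0 (trans (sym (sum≡J x y)) ΣA≡0)))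

  entry-of-columnSum : ∀ l x → Σℚ (λ y → A l y x) ≡ 1ℚ → ∃ λ y → A l y x ≡ 1ℚ
  entry-of-columnSum l x Σ≡1 = map₂ A≢0⇒A≡1 (Σℚ≢0⇒∃≢0 (λ y → A l y x) (λ Σ≡0 → 1≢0 (trans (sym Σ≡1) Σ≡0)))

  column≡δ : ∀ {l u v} → A l v u ≡ 1ℚ → (∀ {y} → A l y u ≡ 1ℚ → y ≡ v) → ∀ y → A l y u ≡ δ y v
  column≡δ {l} {u} {v} Avu≡1 only-v y with y ≟ v | zeroOne l y u
  ... | yes refl | _         = Avu≡1
  ... | no _     | inj₁ A≡0 = A≡0
  ... | no y≢v   | inj₂ A≡1 = ⊥-elim (y≢v (only-v A≡1))

  A-disjoint : ∀ {k l x y} → A k x y ≡ 1ℚ → l ≢ k → A l x y ≡ 0ℚ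
  A-disjoint {k} {l} {x} {y} A≡1 l≢k = begin
    A l x y                    ≡⟨ *-identityʳ (A l x y) ⟨
    A l x y * 1ℚ               ≡⟨ cong (λ e → A l x y * (1ℚ - e)) (δ-≢ l≢k) ⟨
    A l x y * (1ℚ - δ l k)     ≡⟨ Σℚ≡0⇒≡0 others others-nonneg others-sum l ⟩
    0ℚ                         ∎
    where
    open ≡-Reasoning
    others : Fin (suc d) → ℚ
    others j = A j x y * (1ℚ - δ j k)
    others-nonneg : ∀ j → 0ℚ ≤ others j
    others-nonneg j with j ≟ k
    ... | yes _ = ≤-reflexive (sym (*-zeroʳ (A j x y)))
    ... | no _  = subst (0ℚ ≤_) (sym (*-identityʳ (A j x y))) (A-nonneg j x y)
    distribute : ∀ p e → p * (1ℚ - e) ≡ p - p * e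
    distribute = solve-∀ ℚ-ring
    others-sum : Σℚ others ≡ 0ℚ
    others-sum = begin
      Σℚ others                                        ≡⟨ Σℚ-cong (λ j → distribute (A j x y) (δ j k)) ⟩
      Σℚ (λ j → A j x y - A j x y * δ j k)             ≡⟨ Σℚ-distrib-- (λ j → A j x y) (λ j → A j x y * δ j k) ⟩
      Σℚ (λ j → A j x y) - Σℚ (λ j → A j x y * δ j k)  ≡⟨ cong₂ _-_ (sum≡J x y) (Σℚ-*δ (λ j → A j x y) k) ⟩
      1ℚ - A k x y                                     ≡⟨ cong (λ e → 1ℚ - e) A≡1 ⟩
      1ℚ - 1ℚ                                          ≡⟨⟩
      0ℚ                                               ∎

  ⟦⟧-on-class : ∀ β {k x y} → A k x y ≡ 1ℚ → ⟦ β ⟧ x y ≡ β k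
  ⟦⟧-on-class β {k} {x} {y} A≡1 = begin
    ⟦ β ⟧ x y      ≡⟨ Σℚ-single (λ l → β l * A l x y) k (λ l l≢k → trans (cong (β l *_) (A-disjoint A≡1 l≢k)) (*-zeroʳ (β l))) ⟩
    β k * A k x y  ≡⟨ cong (β k *_) A≡1 ⟩
    β k * 1ℚ       ≡⟨ *-identityʳ (β k) ⟩
    β k            ∎
    where open ≡-Reasoning

-- The Grover walk on a graph of an association scheme

module SchemeWalk {n d : ℕ} (G : Graph n) (𝒜 : AssociationScheme n d) (G∈𝒜 : BelongsTo G 𝒜) where
  open Graph G
  open AssociationScheme 𝒜
  open GroverWalk G
  open BoseMesner 𝒜

  cA : Coefficients
  cA = proj₁ G∈𝒜

  a≡⟦cA⟧ : ∀ x y → a x y ≡ ⟦ cA ⟧ x y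
  a≡⟦cA⟧ = proj₂ G∈𝒜

  regular : ∀ x y → degℚ x ≡ degℚ y
  regular x y = begin
    degℚ x                  ≡⟨ Σa≡degℚ x ⟨
    Σℚ (λ z → a z x)        ≡⟨ Σℚ-cong (λ z → a≡⟦cA⟧ z x) ⟩
    Σℚ (λ z → ⟦ cA ⟧ z x)   ≡⟨ ⟦⟧-columnSum-const cA x y ⟩
    Σℚ (λ z → ⟦ cA ⟧ z y)   ≡⟨ Σℚ-cong (λ z → a≡⟦cA⟧ z y) ⟨
    Σℚ (λ z → a z y)        ≡⟨ Σa≡degℚ y ⟩
    degℚ y                  ∎
    where open ≡-Reasoning

  κ-const : ∀ x y → κ x ≡ κ y
  κ-const x y = begin
    κ x                        ≡⟨ *-identityʳ (κ x) ⟨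
    κ x * 1ℚ                   ≡⟨ cong (κ x *_) (κ*degℚ≡1 y) ⟨
    κ x * (κ y * degℚ y)       ≡⟨ cong (λ D → κ x * (κ y * D)) (regular x y) ⟨
    κ x * (κ y * degℚ x)       ≡⟨ rotate (κ x) (κ y) (degℚ x) ⟩
    κ x * degℚ x * κ y         ≡⟨ cong (_* κ y) (κ*degℚ≡1 x) ⟩
    1ℚ * κ y                   ≡⟨ *-identityˡ (κ y) ⟩
    κ y                        ∎
    where
    open ≡-Reasoning
    rotate : ∀ p q r → p * (q * r) ≡ p * r * q
    rotate = solve-∀ ℚ-ring

  InBoseMesner : (Fin n → Fin n → ℚ) → Set
  InBoseMesner M = ∃ λ β → ∀ y x → M y x ≡ ⟦ β ⟧ y x

  -- The vertex only supplies the common degree k, to write W₀ = k · I.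
  walkMatrix₀-in-BM : Fin n → InBoseMesner (walkMatrix 0)
  walkMatrix₀-in-BM o = (λ k → degℚ o * δ k zero) , λ y x → begin
    incoming (onArcs G (χ G x)) y            ≡⟨ incoming-onArcs (χ G x) y ⟩
    incoming (χ G x) y                       ≡⟨ incoming-χ x y ⟩
    degℚ y * δ y x                           ≡⟨ cong₂ _*_ (regular y o) (trans (sym (A₀≡I y x)) (sym (⟦δ⟧≡A zero y x))) ⟩
    degℚ o * ⟦ (λ k → δ k zero) ⟧ y x        ≡⟨ ⟦⟧-scale (degℚ o) (λ k → δ k zero) y x ⟩
    ⟦ (λ k → degℚ o * δ k zero) ⟧ y x        ∎
    where open ≡-Reasoning

  walkMatrix₁-in-BM : InBoseMesner (walkMatrix 1)
  walkMatrix₁-in-BM = cA , λ y x → trans (incoming-cong (U-onArcs (χ G x)) y) (trans (incoming-Uχ x y) (a≡⟦cA⟧ y x))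

  walkMatrix-step-in-BM : Fin n → ∀ {t} → InBoseMesner (walkMatrix t) → InBoseMesner (walkMatrix (suc t)) →
                          InBoseMesner (walkMatrix (suc (suc t)))
  walkMatrix-step-in-BM o {t} (β₀ , W₀) (β₁ , W₁) = (λ k → (κ o + κ o) * (cA ⊛ β₁) k + (- 1ℚ) * β₀ k) , λ y x →
    let S = Σℚ (λ z → a y z * mean (Upow G (suc t) (χ G x)) z)
        P = ⟦ cA ⊛ β₁ ⟧ y x
    in begin
    incoming (U G (Upow G (suc t) (χ G x))) y
      ≡⟨ incoming-U (Upow G (suc t) (χ G x)) y ⟩
    (S + S) - outgoing (U G (Upow G t (χ G x))) y
      ≡⟨ cong₂ (λ p q → (p + p) - q) (S≡κP y x) (trans (outgoing-U (Upow G t (χ G x)) y) (W₀ y x)) ⟩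
    (κ o * P + κ o * P) - ⟦ β₀ ⟧ y x
      ≡⟨ rearrange (κ o) P (⟦ β₀ ⟧ y x) ⟩
    (κ o + κ o) * P + (- 1ℚ) * ⟦ β₀ ⟧ y x
      ≡⟨ cong₂ _+_ (⟦⟧-scale (κ o + κ o) (cA ⊛ β₁) y x) (⟦⟧-scale (- 1ℚ) β₀ y x) ⟩
    ⟦ (λ k → (κ o + κ o) * (cA ⊛ β₁) k) ⟧ y x + ⟦ (λ k → (- 1ℚ) * β₀ k) ⟧ y x
      ≡⟨ ⟦⟧-+ (λ k → (κ o + κ o) * (cA ⊛ β₁) k) (λ k → (- 1ℚ) * β₀ k) y x ⟩
    ⟦ (λ k → (κ o + κ o) * (cA ⊛ β₁) k + (- 1ℚ) * β₀ k) ⟧ y x ∎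
    where
    open ≡-Reasoning
    rearrange : ∀ k p q → (k * p + k * p) - q ≡ (k + k) * p + (- 1ℚ) * q
    rearrange = solve-∀ ℚ-ring
    S≡κP : ∀ y x → Σℚ (λ z → a y z * mean (Upow G (suc t) (χ G x)) z) ≡ κ o * ⟦ cA ⊛ β₁ ⟧ y x
    S≡κP y x = begin
      Σℚ (λ z → a y z * (κ z * walkMatrix (suc t) z x))
        ≡⟨ Σℚ-cong (λ z → cong₂ (λ p q → a y z * (p * q)) (κ-const z o) (W₁ z x)) ⟩
      Σℚ (λ z → a y z * (κ o * ⟦ β₁ ⟧ z x))
        ≡⟨ Σℚ-cong (λ z → trans (swap (a y z) (κ o) (⟦ β₁ ⟧ z x)) (cong (λ p → κ o * (p * ⟦ β₁ ⟧ z x)) (a≡⟦cA⟧ y z))) ⟩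
      Σℚ (λ z → κ o * (⟦ cA ⟧ y z * ⟦ β₁ ⟧ z x))
        ≡⟨ *-distribˡ-Σℚ (κ o) (λ z → ⟦ cA ⟧ y z * ⟦ β₁ ⟧ z x) ⟨
      κ o * Σℚ (λ z → ⟦ cA ⟧ y z * ⟦ β₁ ⟧ z x)
        ≡⟨ cong (κ o *_) (⟦⟧-* cA β₁ y x) ⟩
      κ o * ⟦ cA ⊛ β₁ ⟧ y x ∎
      where
      swap : ∀ p q r → p * (q * r) ≡ q * (p * r)
      swap = solve-∀ ℚ-ring

  walkMatrix-in-BM : Fin n → ∀ t → InBoseMesner (walkMatrix t)
  walkMatrix-in-BM o t = proj₁ (consecutive t)
    where
    consecutive : ∀ t → InBoseMesner (walkMatrix t) × InBoseMesner (walkMatrix (suc t))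
    consecutive zero    = walkMatrix₀-in-BM o , walkMatrix₁-in-BM
    consecutive (suc t) = proj₂ (consecutive t) , walkMatrix-step-in-BM o {t} (proj₁ (consecutive t)) (proj₂ (consecutive t))

  walkMatrix-sym : ∀ t x y → walkMatrix t x y ≡ walkMatrix t y x
  walkMatrix-sym t x y with walkMatrix-in-BM x t
  ... | β , W = trans (W x y) (trans (⟦⟧-sym β x y) (sym (W y x)))

  transfer-involutive : ∀ {t π} → Transfer t π → ∀ x → π (π x) ≡ x
  transfer-involutive {t} {π} T x with T x | T (π x)
  ... | c , c²≡1 , Uχx≈cχπx | c′ , _ , Uχπx≈c′χππx =
    sym (walkMatrix-support {t} {π x} {x} {π (π x)} c′ Uχπx≈c′χππx λ W≡0 →
      c*degℚ≢0 {c} (π x) c²≡1 (begin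
        c * degℚ (π x)          ≡⟨ walkMatrix-at-target {t} {x} {π x} c Uχx≈cχπx ⟨
        walkMatrix t (π x) x    ≡⟨ walkMatrix-sym t (π x) x ⟩
        walkMatrix t x (π x)    ≡⟨ W≡0 ⟩
        0ℚ                      ∎))
    where open ≡-Reasoning

  phase²≡1 : ∀ {u v} c → c * c * degℚ v ≡ degℚ u → c * c ≡ 1ℚ
  phase²≡1 {u} {v} c c²degv≡degu = begin
    c * c                          ≡⟨ *-identityʳ (c * c) ⟨
    c * c * 1ℚ                     ≡⟨ cong (c * c *_) (κ*degℚ≡1 v) ⟨
    c * c * (κ v * degℚ v)         ≡⟨ rotate (c * c) (κ v) (degℚ v) ⟩
    c * c * degℚ v * κ v           ≡⟨ cong (_* κ v) (trans c²degv≡degu (regular u v)) ⟩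
    degℚ v * κ v                   ≡⟨ *-comm (degℚ v) (κ v) ⟩
    κ v * degℚ v                   ≡⟨ κ*degℚ≡1 v ⟩
    1ℚ                             ∎
    where
    open ≡-Reasoning
    rotate : ∀ p q r → p * (q * r) ≡ p * r * q
    rotate = solve-∀ ℚ-ring

  walkMatrix⇒transfer : ∀ {t x z c} → c * c ≡ 1ℚ → walkMatrix t z x ≡ c * degℚ z →
                        Upow G t (χ G x) ≈ scale c (χ G z)
  walkMatrix⇒transfer {t} {x} {z} {c} c²≡1 W≡c·deg =
    cauchy-schwarz-equality (Upow G t (χ G x)) (χ G z) c (degℚ z) norm inner (⟪χ,χ⟫≡degℚ z) c²≡1
    where
    open ≡-Reasoning
    norm : ⟪ Upow G t (χ G x) , Upow G t (χ G x) ⟫ ≡ degℚ z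
    norm = begin
      ⟪ Upow G t (χ G x) , Upow G t (χ G x) ⟫      ≡⟨ Upow-preserves-norm t (χ G x) ⟩
      ⟪ onArcs G (χ G x) , onArcs G (χ G x) ⟫      ≡⟨ ⟪⟫-cong (onArcs-χ x) (onArcs-χ x) ⟩
      ⟪ χ G x , χ G x ⟫                            ≡⟨ ⟪χ,χ⟫≡degℚ x ⟩
      degℚ x                                       ≡⟨ regular x z ⟩
      degℚ z                                       ∎
    inner : ⟪ χ G z , Upow G t (χ G x) ⟫ ≡ c * degℚ z
    inner = trans (⟪χ,f⟫≡incoming z (Upow G t (χ G x))) W≡c·deg

  PST⇒Transfer : ∀ {u v} → PST G u v → ∃ λ t → ∃ λ σ → Transfer t σ × σ u ≡ v
  PST⇒Transfer {u} {v} (_ , τ , c , _ , Uχu≈cχv , c²degv≡degu) = τ , σ , transfer , class-i-only-at-v (σ-spec u)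
    where
    open ≡-Reasoning
    c²≡1 : c * c ≡ 1ℚ
    c²≡1 = phase²≡1 c c²degv≡degu
    β : Coefficients
    β = proj₁ (walkMatrix-in-BM u τ)
    W≡⟦β⟧ : ∀ y x → walkMatrix τ y x ≡ ⟦ β ⟧ y x
    W≡⟦β⟧ = proj₂ (walkMatrix-in-BM u τ)
    i : Fin (suc d)
    i = proj₁ (class v u)
    W-on-class-i : ∀ {y x} → A i y x ≡ 1ℚ → walkMatrix τ y x ≡ c * degℚ v
    W-on-class-i {y} {x} A≡1 = begin
      walkMatrix τ y x      ≡⟨ W≡⟦β⟧ y x ⟩
      ⟦ β ⟧ y x             ≡⟨ ⟦⟧-on-class β A≡1 ⟩
      β i                   ≡⟨ ⟦⟧-on-class β (proj₂ (class v u)) ⟨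
      ⟦ β ⟧ v u             ≡⟨ W≡⟦β⟧ v u ⟨
      walkMatrix τ v u      ≡⟨ walkMatrix-at-target {τ} {u} {v} c Uχu≈cχv ⟩
      c * degℚ v            ∎
    class-i-only-at-v : ∀ {y} → A i y u ≡ 1ℚ → y ≡ v
    class-i-only-at-v {y} A≡1 = walkMatrix-support {τ} {u} {y} {v} c Uχu≈cχv λ W≡0 →
      c*degℚ≢0 {c} v c²≡1 (trans (sym (W-on-class-i A≡1)) W≡0)
    columnSum≡1 : ∀ x → Σℚ (λ y → A i y x) ≡ 1ℚ
    columnSum≡1 x = begin
      Σℚ (λ y → A i y x)         ≡⟨ A-columnSum-const i x u ⟩
      Σℚ (λ y → A i y u)         ≡⟨ Σℚ-cong (λ y → trans (column≡δ (proj₂ (class v u)) class-i-only-at-v y) (sym (*-identityˡ (δ y v)))) ⟩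
      Σℚ (λ y → 1ℚ * δ y v)      ≡⟨ Σℚ-*δ (λ _ → 1ℚ) v ⟩
      1ℚ                         ∎
    σ : Fin n → Fin n
    σ x = proj₁ (entry-of-columnSum i x (columnSum≡1 x))
    σ-spec : ∀ x → A i (σ x) x ≡ 1ℚ
    σ-spec x = proj₂ (entry-of-columnSum i x (columnSum≡1 x))
    transfer : Transfer τ σ
    transfer x = c , c²≡1 , walkMatrix⇒transfer {τ} {x} {σ x} {c} c²≡1
                   (trans (W-on-class-i (σ-spec x)) (cong (c *_) (regular v (σ x))))

proposition3p6 : (n d : ℕ) (G : Graph n) (𝒜 : AssociationScheme n d) →
    BelongsTo G 𝒜 →
    (u v w : Fin n) → PST G u v → PST G u w → v ≡ w
proposition3p6 n d G 𝒜 G∈𝒜 u v w PSTuv PSTuw =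
  let τ  , σ  , Tσ  , σu≡v  = PST⇒Transfer PSTuv
      τ′ , σ′ , Tσ′ , σ′u≡w = PST⇒Transfer PSTuw
  in  conclude σu≡v σ′u≡w (trivialOrEqual {τ} {τ′} Tσ Tσ′)
  where
  open GroverWalk G
  open SchemeWalk G 𝒜 G∈𝒜
  open TransferTimes Transfer transfer-zero (λ {t} → transfer-functional {t}) (λ {t} → transfer-involutive {t})
                     (λ {s} s≤t Ts Tt → transfer-difference s≤t (transfer-involutive {s} Ts) Ts Tt)
  conclude : ∀ {σ σ′} → σ u ≡ v → σ′ u ≡ w → TrivialOrEqual σ σ′ → v ≡ w
  conclude σu≡v _     (inj₁ σ≗id)         = ⊥-elim (proj₁ PSTuv (trans (sym (σ≗id u)) σu≡v))
  conclude _    σ′u≡w (inj₂ (inj₁ σ′≗id)) = ⊥-elim (proj₁ PSTuw (trans (sym (σ′≗id u)) σ′u≡w))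
  conclude σu≡v σ′u≡w (inj₂ (inj₂ σ≗σ′))  = trans (sym σu≡v) (trans (σ≗σ′ u) σ′u≡w)
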